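{- Let $n$ be even with $v_2(n)$ odd. Then $D_{S(n)^*}=C_{S(n)^*}=2$.
   Context: $\mathbb Z_n=\mathbb Z/n\mathbb Z$; $S(n)^*=\{x^2:x\in\mathbb Z_n\}\setminus\{0\}$. $v_2(n)=r$ means $2^r\mid n$, $2^{r+1}\nmid n$. For $A\subseteq\mathbb Z_n$, a subsequence $T$ of a sequence $(x_1,\dots,x_k)$ in $\mathbb Z_n$, with nonempty index set $I$, is an $A$-weighted zero-sum subsequence if there exist $a_i\in A$ ($i\in I$) with $\sum_{i\in I}a_ix_i=0$. $D_{S(n)^*}$ is the least positive integer $k$ such that every sequence of length $k$ in $\mathbb Z_n$ has an $S(n)^*$-weighted zero-sum subsequence; $C_{S(n)^*}$ is the least positive integer $k$ such that every sequence of length $k$ in $\mathbb Z_n$ has an $S(n)^*$-weighted zero-sum subsequence consisting of consecutive terms. -}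

module Defs where

open import Data.Nat using (ℕ; zero; suc; _+_; _*_; _^_; _≤_; _<_; NonZero)
open import Data.Nat.DivMod using (_%_)
open import Data.Nat.Divisibility using (_∣_)
open import Data.Fin using (Fin; toℕ)
open import Data.Bool using (Bool; true; false; if_then_else_)
open import Data.List using (List; map; allFin)
open import Data.Nat.ListAction using (sum)
open import Data.Product using (Σ; ∃; _×_; _,_)
open import Relation.Binary.PropositionalEquality using (_≡_; _≢_)
open import Relation.Nullary using (¬_)

V₂ : ℕ → ℕ → Set
V₂ n r = (2 ^ r ∣ n) × ¬ (2 ^ suc r ∣ n)

IsOdd : ℕ → Set
IsOdd r = ∃ λ m → r ≡ suc (2 * m)

-- Elements of ℤ_n are represented by naturals < n (residues).
-- S(n)^* = { x² : x ∈ ℤ_n } \ {0}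
InS* : (n : ℕ) → .{{NonZero n}} → ℕ → Set
InS* n a = (a < n) × (a ≢ 0) × (∃ λ (x : Fin n) → (toℕ x * toℕ x) % n ≡ a)

weightedSum : (k : ℕ) → (Fin k → Bool) → (Fin k → ℕ) → (Fin k → ℕ) → ℕ
weightedSum k I a x = sum (map (λ i → if I i then a i * x i else 0) (allFin k))

WZSOn : (n : ℕ) → .{{NonZero n}} → (k : ℕ) → (Fin k → Fin n) → (Fin k → Bool) → Set
WZSOn n k x I =
  (∃ λ i → I i ≡ true) ×
  (∃ λ (a : Fin k → ℕ) →
     (∀ i → I i ≡ true → InS* n (a i)) ×
     (weightedSum k I a (λ i → toℕ (x i)) % n ≡ 0))

HasWZS : (n : ℕ) → .{{NonZero n}} → (k : ℕ) → (Fin k → Fin n) → Set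
HasWZS n k x = ∃ λ I → WZSOn n k x I

interval : (k : ℕ) → ℕ → ℕ → Fin k → Bool
interval k l r i with l Data.Nat.≤ᵇ toℕ i | toℕ i Data.Nat.≤ᵇ r
... | true  | true = true
... | _     | _    = false

HasConsecWZS : (n : ℕ) → .{{NonZero n}} → (k : ℕ) → (Fin k → Fin n) → Set
HasConsecWZS n k x = ∃ λ l → ∃ λ r → (l ≤ r) × (r < k) × WZSOn n k x (interval k l r)

IsLeastPos : (ℕ → Set) → ℕ → Set
IsLeastPos P d = (1 ≤ d) × P d × (∀ k → 1 ≤ k → k < d → ¬ P k)

D-S* : (n : ℕ) → .{{NonZero n}} → ℕ → Set
D-S* n d = IsLeastPos (λ k → (x : Fin k → Fin n) → HasWZS n k x) d

C-S* : (n : ℕ) → .{{NonZero n}} → ℕ → Set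
C-S* n d = IsLeastPos (λ k → (x : Fin k → Fin n) → HasConsecWZS n k x) d

-- If v₂(n) = 2s + 1 and n = q·2^(2s+1) with q odd, then h = n/2 = q·(2^s)² is a nonzero square
-- modulo n, since (q·2^s)² = q·h ≡ h (mod 2h).  Weighting by h kills every even residue and
-- every sum of two odd residues, so any two consecutive terms, or one of them, form an
-- S(n)*-weighted zero-sum.  Length one does not suffice: a nonzero weight times 1 is nonzero.
module Submission where

open import Defs
open import Data.Nat using (ℕ; NonZero; ≢-nonZero⁻¹; zero; suc; _+_; _*_; _^_; _<_; z≤n; s≤s; _%_)
open import Data.Nat.Properties
open import Data.Nat.DivMod using (m<n⇒m%n≡m; [m+kn]%n≡m%n; m*n%n≡0; %-distribˡ-*; m%n<n)
open import Data.Nat.Divisibility using (_∣_; divides)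
open import Data.Nat.Tactic.RingSolver using (solve-∀)
open import Data.Fin using (Fin; toℕ; fromℕ<) renaming (zero to fzero; suc to fsuc)
open import Data.Fin.Properties using (toℕ-fromℕ<)
open import Data.Bool using (true)
open import Data.Product using (∃; _×_; _,_)
open import Data.Sum using (_⊎_; inj₁; inj₂)
open import Relation.Binary.PropositionalEquality
open import Relation.Nullary using (¬_; contradiction)

even⊎odd : ∀ x → ∃ λ e → x ≡ e + e ⊎ x ≡ suc (e + e)
even⊎odd zero = 0 , inj₁ refl
even⊎odd (suc x) with even⊎odd x
... | e , inj₁ x≡e+e = e , inj₂ (cong suc x≡e+e)
... | e , inj₂ x≡1+e+e = suc e , inj₁ (trans (cong suc x≡1+e+e) (cong suc (sym (+-suc e e))))

isLeastPos-2 : {P : ℕ → Set} → P 2 → ¬ P 1 → IsLeastPos P 2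
isLeastPos-2 P2 ¬P1 = s≤s z≤n , P2 , λ { .1 (s≤s z≤n) (s≤s (s≤s z≤n)) → ¬P1 }

HasConsecWZS⇒HasWZS : ∀ n .{{_ : NonZero n}} k (x : Fin k → Fin n) → HasConsecWZS n k x → HasWZS n k x
HasConsecWZS⇒HasWZS n k x (l , r , _ , _ , wzs) = interval k l r , wzs

square-InS* : ∀ {n} .{{_ : NonZero n}} {a} c j → c * c ≡ a + j * n → a < n → a ≢ 0 → InS* n a
square-InS* {n} {a} c j c²≡a+jn a<n a≢0 = a<n , a≢0 , fromℕ< (m%n<n c n) , c%n²≡a
  where
  open ≡-Reasoning
  c%n²≡a : (toℕ (fromℕ< (m%n<n c n)) * toℕ (fromℕ< (m%n<n c n))) % n ≡ a
  c%n²≡a rewrite toℕ-fromℕ< (m%n<n c n) = begin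
    ((c % n) * (c % n)) % n ≡⟨ sym (%-distribˡ-* c c n) ⟩
    (c * c) % n             ≡⟨ cong (_% n) c²≡a+jn ⟩
    (a + j * n) % n         ≡⟨ [m+kn]%n≡m%n a j n ⟩
    a % n                   ≡⟨ m<n⇒m%n≡m a<n ⟩
    a                       ∎

¬HasWZS-one : ∀ n .{{_ : NonZero n}} (1<n : 1 < n) → ¬ HasWZS n 1 (λ _ → fromℕ< 1<n)
¬HasWZS-one n 1<n (I , (fzero , _) , a , a∈S* , a·1%n≡0) with I fzero in I0≡true
... | true with a∈S* fzero I0≡true
... | a0<n , a0≢0 , _ = a0≢0 (begin
    a fzero                              ≡⟨ sym (m<n⇒m%n≡m a0<n) ⟩
    a fzero % n                          ≡⟨ cong (_% n) (sym a·1+0≡a) ⟩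
    (a fzero * toℕ (fromℕ< 1<n) + 0) % n ≡⟨ a·1%n≡0 ⟩
    0                                    ∎)
  where
  open ≡-Reasoning
  a·1+0≡a : a fzero * toℕ (fromℕ< 1<n) + 0 ≡ a fzero
  a·1+0≡a rewrite toℕ-fromℕ< 1<n = trans (+-identityʳ _) (*-identityʳ _)

module Half {n h : ℕ} .{{_ : NonZero n}} (n≡h+h : n ≡ h + h) where

  half-*-even : ∀ e → (h * (e + e) + 0) % n ≡ 0
  half-*-even e = begin
    (h * (e + e) + 0) % n ≡⟨ cong (_% n) (trans (rearrange h e) (cong (e *_) (sym n≡h+h))) ⟩
    (e * n) % n           ≡⟨ m*n%n≡0 e n ⟩
    0                     ∎
    where
    open ≡-Reasoning
    rearrange : ∀ h e → h * (e + e) + 0 ≡ e * (h + h)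
    rearrange = solve-∀

  half-*-odd+odd : ∀ e f → (h * suc (e + e) + (h * suc (f + f) + 0)) % n ≡ 0
  half-*-odd+odd e f = begin
    (h * suc (e + e) + (h * suc (f + f) + 0)) % n ≡⟨ cong (_% n) (trans (rearrange h e f) (cong (suc (e + f) *_) (sym n≡h+h))) ⟩
    (suc (e + f) * n) % n                         ≡⟨ m*n%n≡0 (suc (e + f)) n ⟩
    0                                             ∎
    where
    open ≡-Reasoning
    rearrange : ∀ h e f → h * suc (e + e) + (h * suc (f + f) + 0) ≡ suc (e + f) * (h + h)
    rearrange = solve-∀

  consecWZS-2 : InS* n h → (x : Fin 2 → Fin n) → HasConsecWZS n 2 x
  consecWZS-2 h∈S* x with even⊎odd (toℕ (x fzero)) | even⊎odd (toℕ (x (fsuc fzero)))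
  ... | e , inj₁ x₀≡e+e | _ =
    0 , 0 , z≤n , s≤s z≤n , (fzero , refl) , (λ _ → h) , (λ _ _ → h∈S*) ,
    subst (λ t → (h * t + 0) % n ≡ 0) (sym x₀≡e+e) (half-*-even e)
  ... | _ | f , inj₁ x₁≡f+f =
    1 , 1 , s≤s z≤n , s≤s (s≤s z≤n) , (fsuc fzero , refl) , (λ _ → h) , (λ _ _ → h∈S*) ,
    subst (λ t → (h * t + 0) % n ≡ 0) (sym x₁≡f+f) (half-*-even f)
  ... | e , inj₂ x₀≡1+e+e | f , inj₂ x₁≡1+f+f =
    0 , 1 , z≤n , s≤s (s≤s z≤n) , (fzero , refl) , (λ _ → h) , (λ _ _ → h∈S*) ,
    subst₂ (λ t u → (h * t + (h * u + 0)) % n ≡ 0) (sym x₀≡1+e+e) (sym x₁≡1+f+f) (half-*-odd+odd e f)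

V₂-odd-cofactor : ∀ {n} r → V₂ n r → ∃ λ e → n ≡ suc (e + e) * 2 ^ r
V₂-odd-cofactor r (divides q n≡q·2^r , 2^[1+r]∤n) with even⊎odd q
... | e , inj₁ q≡e+e = contradiction (divides e (trans n≡q·2^r (trans (cong (_* 2 ^ r) q≡e+e) (rearrange e (2 ^ r))))) 2^[1+r]∤n
  where
  rearrange : ∀ e X → (e + e) * X ≡ e * (2 * X)
  rearrange = solve-∀
... | e , inj₂ q≡1+e+e = e , trans n≡q·2^r (cong (_* 2 ^ r) q≡1+e+e)

V₂-odd⇒half-square : ∀ {n} → (∃ λ r → V₂ n r × IsOdd r) →
  ∃ λ h → n ≡ h + h × ∃ λ c → ∃ λ j → c * c ≡ h + j * n
V₂-odd⇒half-square {n} (.(suc (2 * s)) , v₂ , s , refl) with V₂-odd-cofactor (suc (2 * s)) v₂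
... | e , n≡q·2^r = h , n≡h+h , q * P , e , (begin
    q * P * (q * P)    ≡⟨ rearrange e P ⟩
    h + e * (h + h)    ≡⟨ cong (λ m → h + e * m) (sym n≡h+h) ⟩
    h + e * n          ∎)
  where
  open ≡-Reasoning
  q P h : ℕ
  q = suc (e + e)
  P = 2 ^ s
  h = q * (P * P)
  2^[1+2s]≡2P² : 2 ^ suc (2 * s) ≡ 2 * (P * P)
  2^[1+2s]≡2P² = cong (2 *_) (trans (^-distribˡ-+-* 2 s (s + 0)) (cong (λ t → P * 2 ^ t) (+-identityʳ s)))
  n≡h+h : n ≡ h + h
  n≡h+h = trans n≡q·2^r (trans (cong (q *_) 2^[1+2s]≡2P²) (+-*-double q (P * P)))
    where
    +-*-double : ∀ q X → q * (2 * X) ≡ q * X + q * X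
    +-*-double = solve-∀
  rearrange : ∀ e P → suc (e + e) * P * (suc (e + e) * P) ≡ suc (e + e) * (P * P) + e * (suc (e + e) * (P * P) + suc (e + e) * (P * P))
  rearrange = solve-∀

-- The hypothesis 2 ∣ n is implied by the valuation hypothesis.
corollary3 : (n : ℕ) → .{{_ : NonZero n}} → 2 ∣ n → (∃ λ r → V₂ n r × IsOdd r) → D-S* n 2 × C-S* n 2
corollary3 n _ v₂-odd with V₂-odd⇒half-square v₂-odd
... | h , n≡h+h , c , j , c²≡h+jn =
  isLeastPos-2 (λ x → HasConsecWZS⇒HasWZS n 2 x (pairs x)) (λ all → ¬HasWZS-one n 1<n (all (λ _ → fromℕ< 1<n))) ,
  isLeastPos-2 pairs (λ all → ¬HasWZS-one n 1<n (HasConsecWZS⇒HasWZS n 1 (λ _ → fromℕ< 1<n) (all (λ _ → fromℕ< 1<n))))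
  where
  h≢0 : h ≢ 0
  h≢0 h≡0 = ≢-nonZero⁻¹ n (trans n≡h+h (cong₂ _+_ h≡0 h≡0))
  h<n : h < n
  h<n = subst (h <_) (sym n≡h+h) (m<m+n h (n≢0⇒n>0 h≢0))
  1<n : 1 < n
  1<n = <-≤-trans (s≤s (n≢0⇒n>0 h≢0)) h<n
  pairs : (x : Fin 2 → Fin n) → HasConsecWZS n 2 x
  pairs = Half.consecWZS-2 n≡h+h (square-InS* c j c²≡h+jn h<n h≢0)
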